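{- Let $P$ be a convex $n$-gon ($n\ge4$) with vertices $1,2,\dots,n$ in cyclic order and let $T$ be the fan triangulation with diagonals $(1,3),(1,4),\dots,(1,n-1)$; let $\Delta_i=(1,i+1,i+2)$, $1\le i\le n-2$. Then every super $T$-path from $2$ to $n$ which uses at least one $\sigma$-edge or $\tau$-edge is of the form \[(2,1,\theta_i,\theta_j,1,n\mid (2,1),\sigma_i,\tau_{ij},\sigma_j,(1,n))\] for some $1\le i<j\le n-2$.
   Context: Auxiliary graph for the arc $(2,n)$: its vertices are the vertices $1,\dots,n$ of $P$ together with new vertices $\theta_1,\dots,\theta_{n-2}$, $\theta_i$ lying inside $\Delta_i$; its edges are the arcs of $T$ (diagonals and boundary edges), the $\sigma$-edges $\sigma_i$ joining $\theta_i$ to vertex $1$, and the $\tau$-edges $\tau_{ij}$ joining $\theta_i$ and $\theta_j$ for $i<j$. The edges $(1,i+2)$ ($1\le i\le n-3$), assigned position $i+\frac12$, and $\sigma_i$, assigned position $i$, are said to cross $(2,n)$; no other edge does. A super $T$-path from $2$ to $n$ is a sequence $(a_0,\dots,a_\ell\mid t_1,\dots,t_\ell)$ with $a_0=2$, $a_\ell=n$ vertices of the auxiliary graph, $t_i$ an edge joining $a_{i-1}$ and $a_i$, such that: the $t_i$ are pairwise distinct; $\ell$ is odd; $t_i$ crosses $(2,n)$ whenever $i$ is even; $\sigma$-edges occur only at even steps and $\tau$-edges only at odd steps; if $i<j$ and both $t_i,t_j$ cross $(2,n)$, the position of $t_i$ is smaller than that of $t_j$. -}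

module Defs where

open import Data.Nat using (ℕ; zero; suc; _+_; _*_; _∸_; _≤_; _<_)
open import Data.Product using (Σ; ∃; _×_; _,_)
open import Data.Sum using (_⊎_)
open import Relation.Binary.PropositionalEquality using (_≡_; _≢_)

-- Vertices of the auxiliary graph for the arc (2,n), fan triangulation T of
-- the convex n-gon P with diagonals (1,3),...,(1,n-1).
--   pt k : polygon vertex k   (1 ≤ k ≤ n)
--   θ i  : new vertex θ_i inside Δ_i = (1,i+1,i+2)   (1 ≤ i ≤ n-2)
data Vtx : Set where
  pt : ℕ → Vtx
  θ  : ℕ → Vtx

-- Edges of the auxiliary graph.
--   arc a b : arc (a,b) of T, always stored with a < b
--   σ i     : σ-edge σ_i joining θ_i and vertex 1
--   τ i j   : τ-edge τ_ij joining θ_i and θ_j (i < j)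
data Edge : Set where
  arc : ℕ → ℕ → Edge
  σ   : ℕ → Edge
  τ   : ℕ → ℕ → Edge

data ArcT (n : ℕ) : ℕ → ℕ → Set where
  from1    : ∀ {b} → 2 ≤ b → b ≤ n → ArcT n 1 b
  boundary : ∀ {a} → 1 ≤ a → suc a ≤ n → ArcT n a (suc a)

data Joins (n : ℕ) : Edge → Vtx → Vtx → Set where
  arc-fw : ∀ {a b} → ArcT n a b → Joins n (arc a b) (pt a) (pt b)
  arc-bw : ∀ {a b} → ArcT n a b → Joins n (arc a b) (pt b) (pt a)
  σ-fw   : ∀ {i} → 1 ≤ i → i ≤ n ∸ 2 → Joins n (σ i) (θ i) (pt 1)
  σ-bw   : ∀ {i} → 1 ≤ i → i ≤ n ∸ 2 → Joins n (σ i) (pt 1) (θ i)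
  τ-fw   : ∀ {i j} → 1 ≤ i → i < j → j ≤ n ∸ 2 → Joins n (τ i j) (θ i) (θ j)
  τ-bw   : ∀ {i j} → 1 ≤ i → i < j → j ≤ n ∸ 2 → Joins n (τ i j) (θ j) (θ i)

-- Crosses n e p : e crosses (2,n) and has position p/2 (positions doubled to
-- stay in ℕ): (1,i+2) has position i+1/2 (doubled 2i+1), 1 ≤ i ≤ n-3;
-- σ_i has position i (doubled 2i), 1 ≤ i ≤ n-2.
data Crosses (n : ℕ) : Edge → ℕ → Set where
  cr-arc : ∀ {i} → 1 ≤ i → i ≤ n ∸ 3 → Crosses n (arc 1 (suc (suc i))) (suc (2 * i))
  cr-σ   : ∀ {i} → 1 ≤ i → i ≤ n ∸ 2 → Crosses n (σ i) (2 * i)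

CrossesArc : ℕ → Edge → Set
CrossesArc n e = ∃ λ p → Crosses n e p

data IsSigma : Edge → Set where
  isσ : ∀ {i} → IsSigma (σ i)

data IsTau : Edge → Set where
  isτ : ∀ {i j} → IsTau (τ i j)

Even : ℕ → Set
Even m = ∃ λ k → m ≡ 2 * k

Odd : ℕ → Set
Odd m = ∃ λ k → m ≡ suc (2 * k)

-- A super T-path from 2 to n: (a_0,...,a_ℓ | t_1,...,t_ℓ).  Only the values
-- a 0..a ℓ and t 1..t ℓ are meaningful.
record SuperTPath (n : ℕ) : Set where
  field
    ℓ : ℕ
    a : ℕ → Vtx
    t : ℕ → Edge
    start    : a 0 ≡ pt 2
    end      : a ℓ ≡ pt n
    joins    : ∀ i → 1 ≤ i → i ≤ ℓ → Joins n (t i) (a (i ∸ 1)) (a i)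
    distinct : ∀ i j → 1 ≤ i → i < j → j ≤ ℓ → t i ≢ t j
    ℓ-odd    : Odd ℓ
    even-crosses : ∀ i → 1 ≤ i → i ≤ ℓ → Even i → CrossesArc n (t i)
    σ-even   : ∀ i → 1 ≤ i → i ≤ ℓ → IsSigma (t i) → Even i
    τ-odd    : ∀ i → 1 ≤ i → i ≤ ℓ → IsTau (t i) → Odd i
    ordered  : ∀ i j p q → 1 ≤ i → i < j → j ≤ ℓ →
               Crosses n (t i) p → Crosses n (t j) q → p < q

-- A θ-vertex can only be entered or left along a σ-edge at an even step or a
-- τ-edge at an odd step, and τ-edges join two θ's.  So any σ- or τ-edge forces
-- a detour 1, θ_i, θ_j, 1 whose first vertex sits at an odd position, with
-- i < j because crossing positions increase.  An odd step at vertex 1 is an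
-- arc (1,x) with x ≠ 1; as (1,x) is the only crossing edge at x, an adjacent
-- even step at x would repeat it.  Hence the detour is preceded only by the
-- step (2,1) and followed only by (1,n).
module Submission where

open import Defs
open import Data.Nat using (ℕ; zero; suc; _+_; _∸_; _≤_; _<_; z≤n; s≤s; _≟_)
open import Data.Nat.Properties
  using (suc-injective; *-suc; *-cancelˡ-<; <-asym; ≤∧≢⇒<; n≤1+n; n<1+n; ≤-trans; m≤n+m)
open import Data.Product using (∃; ∃₂; _×_; _,_)
open import Data.Sum using (_⊎_; inj₁; inj₂)
open import Data.Empty using (⊥; ⊥-elim)
open import Relation.Nullary using (¬_; yes; no)
open import Relation.Binary.PropositionalEquality
  using (_≡_; _≢_; refl; sym; trans; cong; subst)

private
  variable
    m k c x w : ℕ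
    e : Edge
    u v : Vtx

even⇒odd-suc : Even m → Odd (suc m)
even⇒odd-suc (k , m≡2k) = k , cong suc m≡2k

odd⇒even-suc : Odd m → Even (suc m)
odd⇒even-suc (k , m≡1+2k) = suc k , trans (cong suc m≡1+2k) (sym (*-suc 2 k))

even-suc⇒odd : Even (suc m) → Odd m
even-suc⇒odd (zero , ())
even-suc⇒odd (suc k , 1+m≡2+2k) = k , suc-injective (trans 1+m≡2+2k (*-suc 2 k))

odd-suc⇒even : Odd (suc m) → Even m
odd-suc⇒even (k , 1+m≡1+2k) = k , suc-injective 1+m≡1+2k

¬even∧odd : Even m → Odd m → ⊥
¬even∧odd {zero}  _ (_ , ())
¬even∧odd {suc m} e o = ¬even∧odd (odd-suc⇒even o) (even-suc⇒odd e)

pt≢θ : pt k ≢ θ x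
pt≢θ ()

2≤⇒≢1 : 2 ≤ x → x ≢ 1
2≤⇒≢1 (s≤s ()) refl

module _ {n : ℕ} where

  joins-into-θ : Joins n e u (θ x) →
    (e ≡ σ x × u ≡ pt 1 × 1 ≤ x × x ≤ n ∸ 2) ⊎ (IsTau e × ∃ λ w → u ≡ θ w)
  joins-into-θ (σ-bw 1≤x x≤n-2) = inj₁ (refl , refl , 1≤x , x≤n-2)
  joins-into-θ (τ-fw _ _ _)     = inj₂ (isτ , _ , refl)
  joins-into-θ (τ-bw _ _ _)     = inj₂ (isτ , _ , refl)

  joins-out-of-θ : Joins n e (θ x) v →
    (e ≡ σ x × v ≡ pt 1 × 1 ≤ x × x ≤ n ∸ 2) ⊎ (IsTau e × ∃ λ w → v ≡ θ w)
  joins-out-of-θ (σ-fw 1≤x x≤n-2) = inj₁ (refl , refl , 1≤x , x≤n-2)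
  joins-out-of-θ (τ-fw _ _ _)     = inj₂ (isτ , _ , refl)
  joins-out-of-θ (τ-bw _ _ _)     = inj₂ (isτ , _ , refl)

  joins-into-1 : Joins n e u (pt 1) →
    IsSigma e ⊎ (∃ λ x → x ≢ 1 × e ≡ arc 1 x × u ≡ pt x)
  joins-into-1 (arc-fw (from1 (s≤s ()) _))
  joins-into-1 (arc-fw (boundary () _))
  joins-into-1 (arc-bw (from1 2≤x _)) = inj₂ (_ , 2≤⇒≢1 2≤x , refl , refl)
  joins-into-1 (arc-bw (boundary _ _)) = inj₂ (2 , (λ ()) , refl , refl)
  joins-into-1 (σ-fw _ _)              = inj₁ isσ

  joins-out-of-1 : Joins n e (pt 1) v →
    IsSigma e ⊎ (∃ λ x → x ≢ 1 × e ≡ arc 1 x × v ≡ pt x)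
  joins-out-of-1 (arc-fw (from1 2≤x _)) = inj₂ (_ , 2≤⇒≢1 2≤x , refl , refl)
  joins-out-of-1 (arc-fw (boundary _ _)) = inj₂ (2 , (λ ()) , refl , refl)
  joins-out-of-1 (arc-bw (from1 (s≤s ()) _))
  joins-out-of-1 (arc-bw (boundary () _))
  joins-out-of-1 (σ-bw _ _)              = inj₁ isσ

  σ-has-θ-end : Joins n e u v → IsSigma e → (∃ λ y → u ≡ θ y) ⊎ (∃ λ y → v ≡ θ y)
  σ-has-θ-end (σ-fw _ _) _ = inj₁ (_ , refl)
  σ-has-θ-end (σ-bw _ _) _ = inj₂ (_ , refl)

  τ-forward : Joins n e (θ w) (θ x) → w < x → e ≡ τ w x
  τ-forward (τ-fw _ _ _) _   = refl
  τ-forward (τ-bw _ x<w _) w<x = ⊥-elim (<-asym x<w w<x)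

  τ-into-θ : Joins n e u v → IsTau e → ∃ λ y → v ≡ θ y
  τ-into-θ (τ-fw _ _ _) _ = _ , refl
  τ-into-θ (τ-bw _ _ _) _ = _ , refl

  crossing-into-pt : ∀ {p} → Crosses n e p → Joins n e u (pt x) → x ≢ 1 → e ≡ arc 1 x
  crossing-into-pt (cr-arc _ _) (arc-fw _)   _   = refl
  crossing-into-pt (cr-arc _ _) (arc-bw _)   x≢1 = ⊥-elim (x≢1 refl)
  crossing-into-pt (cr-σ _ _)   (σ-fw _ _)   x≢1 = ⊥-elim (x≢1 refl)

  crossing-out-of-pt : ∀ {p} → Crosses n e p → Joins n e (pt x) v → x ≢ 1 → e ≡ arc 1 x
  crossing-out-of-pt (cr-arc _ _) (arc-fw _) x≢1 = ⊥-elim (x≢1 refl)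
  crossing-out-of-pt (cr-arc _ _) (arc-bw _) _   = refl
  crossing-out-of-pt (cr-σ _ _)   (σ-bw _ _) x≢1 = ⊥-elim (x≢1 refl)

module SuperTPathProperties {n : ℕ} (γ : SuperTPath n) where
  open SuperTPath γ

  step : ∀ k → suc k ≤ ℓ → Joins n (t (suc k)) (a k) (a (suc k))
  step k le = joins (suc k) (s≤s z≤n) le

  step-between : suc k ≤ ℓ → a k ≡ u → a (suc k) ≡ v → Joins n (t (suc k)) u v
  step-between {k} le refl refl = step k le

  odd-step-not-σ : Odd (suc k) → suc k ≤ ℓ → ¬ IsSigma (t (suc k))
  odd-step-not-σ odd le σ-step = ¬even∧odd (σ-even _ (s≤s z≤n) le σ-step) odd

  even-step-not-τ : Even (suc k) → suc k ≤ ℓ → ¬ IsTau (t (suc k))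
  even-step-not-τ even le τ-step = ¬even∧odd even (τ-odd _ (s≤s z≤n) le τ-step)

  θ-before-end : k ≤ ℓ → a k ≡ θ x → k < ℓ
  θ-before-end k≤ℓ ak≡θ = ≤∧≢⇒< k≤ℓ λ { refl → pt≢θ (trans (sym end) ak≡θ) }

  even-step-into-θ : Even (suc k) → suc k ≤ ℓ → a (suc k) ≡ θ x →
    t (suc k) ≡ σ x × a k ≡ pt 1 × 1 ≤ x × x ≤ n ∸ 2
  even-step-into-θ even le eq with joins-into-θ (step-between le refl eq)
  ... | inj₁ σ-step       = σ-step
  ... | inj₂ (τ-step , _) = ⊥-elim (even-step-not-τ even le τ-step)

  even-step-out-of-θ : Even (suc k) → suc k ≤ ℓ → a k ≡ θ x →
    t (suc k) ≡ σ x × a (suc k) ≡ pt 1 × 1 ≤ x × x ≤ n ∸ 2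
  even-step-out-of-θ even le eq with joins-out-of-θ (step-between le eq refl)
  ... | inj₁ σ-step       = σ-step
  ... | inj₂ (τ-step , _) = ⊥-elim (even-step-not-τ even le τ-step)

  odd-step-into-θ : Odd (suc k) → suc k ≤ ℓ → a (suc k) ≡ θ x → ∃ λ w → a k ≡ θ w
  odd-step-into-θ odd le eq with joins-into-θ (step-between le refl eq)
  ... | inj₁ (tσ , _)    = ⊥-elim (odd-step-not-σ odd le (subst IsSigma (sym tσ) isσ))
  ... | inj₂ (_ , θ-end) = θ-end

  odd-step-out-of-θ : Odd (suc k) → suc k ≤ ℓ → a k ≡ θ x → ∃ λ w → a (suc k) ≡ θ w
  odd-step-out-of-θ odd le eq with joins-out-of-θ (step-between le eq refl)
  ... | inj₁ (tσ , _)    = ⊥-elim (odd-step-not-σ odd le (subst IsSigma (sym tσ) isσ))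
  ... | inj₂ (_ , θ-end) = θ-end

  odd-step-into-1 : Odd (suc k) → suc k ≤ ℓ → a (suc k) ≡ pt 1 →
    ∃ λ x → x ≢ 1 × t (suc k) ≡ arc 1 x × a k ≡ pt x
  odd-step-into-1 odd le eq with joins-into-1 (step-between le refl eq)
  ... | inj₁ σ-step   = ⊥-elim (odd-step-not-σ odd le σ-step)
  ... | inj₂ arc-step = arc-step

  odd-step-out-of-1 : Odd (suc k) → suc k ≤ ℓ → a k ≡ pt 1 →
    ∃ λ x → x ≢ 1 × t (suc k) ≡ arc 1 x × a (suc k) ≡ pt x
  odd-step-out-of-1 odd le eq with joins-out-of-1 (step-between le eq refl)
  ... | inj₁ σ-step   = ⊥-elim (odd-step-not-σ odd le σ-step)
  ... | inj₂ arc-step = arc-step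

  σ-indices-increase : ∀ {i j} → 1 ≤ i → i < j → j ≤ ℓ →
    t i ≡ σ w → 1 ≤ w → w ≤ n ∸ 2 → t j ≡ σ x → 1 ≤ x → x ≤ n ∸ 2 → w < x
  σ-indices-increase 1≤i i<j j≤ℓ ti≡σw 1≤w w≤n∸2 tj≡σx 1≤x x≤n∸2 =
    *-cancelˡ-< 2 _ _ (ordered _ _ _ _ 1≤i i<j j≤ℓ
      (subst (λ e → Crosses n e _) (sym ti≡σw) (cr-σ 1≤w w≤n∸2))
      (subst (λ e → Crosses n e _) (sym tj≡σx) (cr-σ 1≤x x≤n∸2)))

  θ-at-odd-position : (∃ λ k → 1 ≤ k × k ≤ ℓ × (IsSigma (t k) ⊎ IsTau (t k))) →
    ∃₂ λ c x → Odd c × c ≤ ℓ × a c ≡ θ x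
  θ-at-odd-position (suc k , _ , le , inj₂ τ-step) =
    let (y , ak+1≡θy) = τ-into-θ (step k le) τ-step
    in suc k , y , τ-odd _ (s≤s z≤n) le τ-step , le , ak+1≡θy
  θ-at-odd-position (suc k , _ , le , inj₁ σ-step)
    with σ-even _ (s≤s z≤n) le σ-step | σ-has-θ-end (step k le) σ-step
  ... | even | inj₁ (y , ak≡θy) = k , y , even-suc⇒odd even , ≤-trans (n≤1+n k) le , ak≡θy
  ... | even | inj₂ (y , ak+1≡θy) =
    let lt = θ-before-end le ak+1≡θy
        (w , ak+2≡θw) = odd-step-out-of-θ (even⇒odd-suc even) lt ak+1≡θy
    in suc (suc k) , w , even⇒odd-suc even , lt , ak+2≡θw

  record Excursion (b i j : ℕ) : Set where
    field
      b-odd       : Odd b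
      ends-before : 3 + b ≤ ℓ
      1≤i         : 1 ≤ i
      i<j         : i < j
      j≤n∸2       : j ≤ n ∸ 2
      leaves-1    : a b ≡ pt 1
      visits-θi   : a (1 + b) ≡ θ i
      visits-θj   : a (2 + b) ≡ θ j
      returns-1   : a (3 + b) ≡ pt 1
      takes-σi    : t (1 + b) ≡ σ i
      takes-τij   : t (2 + b) ≡ τ i j
      takes-σj    : t (3 + b) ≡ σ j

  excursion-through-θ : Odd c → c ≤ ℓ → a c ≡ θ x → ∃₂ λ b w → Excursion b w x
  excursion-through-θ {zero} (_ , ())
  excursion-through-θ {suc zero} odd le a1≡θ with odd-step-into-θ odd le a1≡θ
  ... | _ , a0≡θ = ⊥-elim (pt≢θ (trans (sym start) a0≡θ))
  excursion-through-θ {suc (suc b)} {x} odd le a≡θx with odd-step-into-θ odd le a≡θx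
  ... | w , a≡θw =
    let even   = odd-suc⇒even odd
        before = ≤-trans (n≤1+n _) le
        after  = θ-before-end le a≡θx
        (tσw , ab≡1 , 1≤w , w≤n∸2) = even-step-into-θ even before a≡θw
        (tσx , a≡1 , 1≤x , x≤n∸2)  = even-step-out-of-θ (odd⇒even-suc odd) after a≡θx
        w<x = σ-indices-increase (s≤s z≤n) (s≤s (n≤1+n _)) after
                tσw 1≤w w≤n∸2 tσx 1≤x x≤n∸2
    in b , w , record
      { b-odd = even-suc⇒odd even ; ends-before = after
      ; 1≤i = 1≤w ; i<j = w<x ; j≤n∸2 = x≤n∸2
      ; leaves-1 = ab≡1 ; visits-θi = a≡θw ; visits-θj = a≡θx ; returns-1 = a≡1
      ; takes-σi = tσw ; takes-τij = τ-forward (step-between le a≡θw a≡θx) w<x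
      ; takes-σj = tσx }

  odd-visit-to-1 : Odd k → k ≤ ℓ → a k ≡ pt 1 → k ≡ 1 × t 1 ≡ arc 1 2
  odd-visit-to-1 {zero} (_ , ())
  odd-visit-to-1 {suc zero} odd le a1≡1 with odd-step-into-1 odd le a1≡1
  ... | _ , _ , t1≡arc , a0≡x with trans (sym start) a0≡x
  ...   | refl = refl , t1≡arc
  odd-visit-to-1 {suc (suc m)} odd le a≡1 with odd-step-into-1 odd le a≡1
  ... | x , x≢1 , t≡arc , a≡x =
    let before        = ≤-trans (n≤1+n _) le
        (_ , crosses) = even-crosses (suc m) (s≤s z≤n) before (odd-suc⇒even odd)
        t'≡arc        = crossing-into-pt crosses (step-between before refl a≡x) x≢1
    in ⊥-elim (distinct _ _ (s≤s z≤n) (n<1+n _) le (trans t'≡arc (sym t≡arc)))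

  even-before-end : Even k → k ≤ ℓ → k < ℓ
  even-before-end even le = ≤∧≢⇒< le λ { refl → ¬even∧odd even ℓ-odd }

  even-visit-to-1 : Even k → k ≤ ℓ → a k ≡ pt 1 →
    suc k ≡ ℓ × a (suc k) ≡ pt n × t (suc k) ≡ arc 1 n
  even-visit-to-1 {k} even le ak≡1
    with odd-step-out-of-1 (even⇒odd-suc even) (even-before-end even le) ak≡1 | suc k ≟ ℓ
  ... | x , x≢1 , t≡arc , a≡x | no k+1≢ℓ =
    let after         = ≤∧≢⇒< (even-before-end even le) k+1≢ℓ
        even'         = odd⇒even-suc (even⇒odd-suc even)
        (_ , crosses) = even-crosses (suc (suc k)) (s≤s z≤n) after even'
        t'≡arc        = crossing-out-of-pt crosses (step-between after a≡x refl) x≢1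
    in ⊥-elim (distinct _ _ (s≤s z≤n) (n<1+n _) after (trans t≡arc (sym t'≡arc)))
  ... | _ , _ , t≡arc , a≡x | yes k+1≡ℓ
    with trans (sym a≡x) (subst (λ m → a m ≡ pt n) (sym k+1≡ℓ) end)
  ...   | refl = k+1≡ℓ , a≡x , t≡arc

  excursion-from-1 : (∃ λ k → 1 ≤ k × k ≤ ℓ × (IsSigma (t k) ⊎ IsTau (t k))) →
    ∃₂ λ i j → Excursion 1 i j × t 1 ≡ arc 1 2
  excursion-from-1 uses-σ-or-τ with θ-at-odd-position uses-σ-or-τ
  ... | _ , j , odd , le , a≡θj with excursion-through-θ odd le a≡θj
  ... | b , i , E with odd-visit-to-1 (Excursion.b-odd E)
                        (≤-trans (m≤n+m b 3) (Excursion.ends-before E)) (Excursion.leaves-1 E)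
  ...   | refl , t1≡arc = i , j , E , t1≡arc

lemma5p15 : (n : ℕ) → 4 ≤ n → (γ : SuperTPath n) →
    let open SuperTPath γ in
    (∃ λ k → 1 ≤ k × k ≤ ℓ × (IsSigma (t k) ⊎ IsTau (t k))) →
    ∃ λ i → ∃ λ j → 1 ≤ i × i < j × j ≤ n ∸ 2 ×
    ℓ ≡ 5 ×
    a 0 ≡ pt 2 × a 1 ≡ pt 1 × a 2 ≡ θ i × a 3 ≡ θ j × a 4 ≡ pt 1 × a 5 ≡ pt n ×
    t 1 ≡ arc 1 2 × t 2 ≡ σ i × t 3 ≡ τ i j × t 4 ≡ σ j × t 5 ≡ arc 1 n
lemma5p15 n _ γ uses-σ-or-τ =
  let open SuperTPath γ
      open SuperTPathProperties γ
      (i , j , E , t1≡arc) = excursion-from-1 uses-σ-or-τ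
      open Excursion E
      (5≡ℓ , a5≡n , t5≡arc) = even-visit-to-1 (2 , refl) ends-before returns-1
  in i , j , 1≤i , i<j , j≤n∸2 , sym 5≡ℓ ,
     start , leaves-1 , visits-θi , visits-θj , returns-1 , a5≡n ,
     t1≡arc , takes-σi , takes-τij , takes-σj , t5≡arc
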